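{- Let $\ell \geq 1$ and let $H_\ell$ be the cocktail party graph on $2^\ell$ vertices. Let $1 \leq \delta \leq \ell$ and let $\mathcal{C}_0$ be a set of $\delta$ clique twins in $H_\ell$ with the following property: if one chooses one clique from each of the $\delta$ clique twins, the intersection of the vertex sets of the chosen cliques has size exactly $2^{\ell-\delta}$. Then there exists a twin clique cover $\mathcal{C}$ of $H_\ell$ of size $2\ell$ that contains (all cliques of) $\mathcal{C}_0$.
   Context: For an integer $\ell \geq 1$, $H_\ell$ denotes the complete graph on $2^\ell$ vertices with a perfect matching removed. A maximum clique of $H_\ell$ has $2^{\ell-1}$ vertices. A pair of maximum cliques $C$ and $V(H_\ell)\setminus C$ of $H_\ell$ is called clique twins. A clique cover of a graph is a family of cliques (vertex sets inducing complete subgraphs) such that every edge has both endpoints in some member of the family; a clique cover of $H_\ell$ that consists of clique twins (i.e., is a union of pairs of clique twins) is called a twin clique cover. -}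

module Defs where

open import Data.Nat using (ℕ; _≤_; _^_; _∸_; _*_)
open import Data.Nat.DivMod using (_/_)
open import Data.Fin using (Fin; toℕ)
open import Data.Fin.Subset using (Subset; _∈_; ∁; _∩_; ⊤; ∣_∣)
open import Data.Vec using (Vec; lookup)
open import Data.Bool using (Bool; if_then_else_)
open import Data.Product using (_×_; ∃-syntax)
open import Data.Sum using (_⊎_)
open import Relation.Binary.PropositionalEquality using (_≡_; _≢_)

-- Vertices of H_ℓ : Fin (2 ^ ℓ).  The removed perfect matching is
-- { {2i, 2i+1} }, i.e. u and v are matched iff ⌊u/2⌋ = ⌊v/2⌋, u ≢ v.
Vtx : ℕ → Set
Vtx ℓ = Fin (2 ^ ℓ)

Adj : (ℓ : ℕ) → Vtx ℓ → Vtx ℓ → Set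
Adj ℓ u v = (u ≢ v) × (toℕ u / 2 ≢ toℕ v / 2)

IsClique : (ℓ : ℕ) → Subset (2 ^ ℓ) → Set
IsClique ℓ S = ∀ u v → u ∈ S → v ∈ S → u ≢ v → Adj ℓ u v

IsMaxClique : (ℓ : ℕ) → Subset (2 ^ ℓ) → Set
IsMaxClique ℓ S = IsClique ℓ S × (∀ T → IsClique ℓ T → ∣ T ∣ ≤ ∣ S ∣)

-- A pair of clique twins {C, V∖C} is represented by C (a maximum clique).
-- Two twin pairs represented by C and D are equal iff C ≡ D or C ≡ ∁ D.
SameTwins : {n : ℕ} → Subset n → Subset n → Set
SameTwins C D = (C ≡ D) ⊎ (C ≡ ∁ D)

DistinctTwins : {n k : ℕ} → Vec (Subset n) k → Set
DistinctTwins {k = k} D = ∀ (i j : Fin k) → i ≢ j → ¬' (SameTwins (lookup D i) (lookup D j))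
  where
  open import Data.Empty using (⊥)
  ¬' : Set → Set
  ¬' A = A → ⊥

choose : {n : ℕ} → Bool → Subset n → Subset n
choose b C = if b then C else ∁ C

chosenMeet : {n k : ℕ} → Vec (Subset n) k → (Fin k → Bool) → Subset n
chosenMeet {n} {k} C ε = go k (λ i → choose (ε i) (lookup C i))
  where
  open import Data.Fin using (zero; suc)
  go : (m : ℕ) → (Fin m → Subset n) → Subset n
  go ℕ.zero f = ⊤
  go (ℕ.suc m) f = f zero ∩ go m (λ i → f (suc i))

-- twin clique cover of H_ℓ given by representatives D : the family
-- { D j , ∁ (D j) | j }; every edge lies inside some member
IsTwinCliqueCover : (ℓ k : ℕ) → Vec (Subset (2 ^ ℓ)) k → Set
IsTwinCliqueCover ℓ k D =
  (∀ j → IsMaxClique ℓ (lookup D j)) ×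
  (∀ u v → Adj ℓ u v → ∃[ j ] ((u ∈ lookup D j × v ∈ lookup D j) ⊎ (u ∈ ∁ (lookup D j) × v ∈ ∁ (lookup D j))))

-- The vertex u of H_ℓ is matched with its partner u xor 1.  A maximum clique is exactly a
-- transversal of the matching: it contains one vertex of every matched pair.  Hence ℓ maximum
-- cliques D_1 … D_ℓ are the same thing as a code assigning to every vertex v the word
-- (v ∈ D_1, …, v ∈ D_ℓ), antipodal in the sense that partners get complementary words.  If
-- this code is injective, the twin pairs of the D_j cover H_ℓ: two vertices whose words
-- disagree everywhere are partners, hence not adjacent.  The pairs are distinct by
-- pigeonhole, since otherwise ℓ - 1 coordinates would already separate the 2^ℓ vertices.
--
-- The given δ twin pairs contribute the first δ coordinates.  They split the vertices into
-- cells of size 2^(ℓ-δ), and the remaining ℓ - δ coordinates are the binary digits of the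
-- rank of a vertex in its cell.  To make them antipodal, this is done only for vertices of
-- the first given clique; a vertex outside it gets the complement of its partner's digits.

module Submission where

open import Defs
open import Data.Nat using (ℕ; _≤_; _^_; _∸_; _*_)
open import Data.Fin using (Fin)
open import Data.Fin.Subset using (Subset; ∣_∣)
open import Data.Vec using (Vec; lookup)
open import Data.Bool using (Bool)
open import Data.Product using (_×_; ∃-syntax)
open import Relation.Binary.PropositionalEquality using (_≡_)

open import Data.Nat using (zero; suc; _+_; _/_; _<_; z≤n; s≤s)
open import Data.Nat.Properties
  using (suc-injective; 0≢1+n; +-suc; 1+n≰n; ≤-reflexive; <-≤-trans; n<1+n; ^-monoʳ-<;
         m+n∸m≡n; m≤n⇒∃[o]m+o≡n)
open import Data.Nat.DivMod using (m/n≡1+[m∸n]/n)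
open import Data.Fin as Fin
  using (toℕ; fromℕ<; _↑ˡ_; splitAt; punchIn; punchOut; finToFun; funToFin)
open import Data.Fin.Properties
  using (2↔Bool; toℕ-fromℕ<; funToFin-finToFin; finToFun-funToFin;
         pigeonhole; punchIn-punchOut; any?; <⇒≢)
  renaming (suc-injective to Fin-suc-injective)
open import Data.Fin.Subset using (_∈_; _∉_; ∁; _∩_; inside; outside)
open import Data.Fin.Subset.Properties using (∈⊤; x∈p∩q⁺)
open import Data.Vec using (_∷_; []; here; there; tabulate; _[_]≔_)
open import Data.Vec.Properties
  using ([]=⇒lookup; lookup⇒[]=; lookup∘update′; lookup-map; lookup∘tabulate;
         tabulate∘lookup; tabulate-cong)
open import Data.Vec.Functional using (_++_)
open import Data.Vec.Functional.Properties using (++-injectiveˡ; ++-injectiveʳ; lookup-++ˡ)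
open import Data.Bool as Bool using (true; false; not; _xor_)
open import Data.Bool.Properties using (not-involutive; not-injective; ¬-not; not-distribˡ-xor)
open import Data.Product using (_,_; proj₂)
open import Data.Sum using (_⊎_; inj₁; inj₂)
open import Data.Empty using (⊥-elim)
open import Function using (_∘_; id; flip; Inverse)
open import Relation.Binary.PropositionalEquality
  using (_≢_; _≗_; refl; sym; trans; cong; cong₂; subst; module ≡-Reasoning)
open import Relation.Nullary using (¬_; yes; no)

partner : ∀ {n} → Fin n → Fin n
partner {suc (suc n)} Fin.zero = Fin.suc Fin.zero
partner {suc (suc n)} (Fin.suc Fin.zero) = Fin.zero
partner {suc (suc n)} (Fin.suc (Fin.suc u)) = Fin.suc (Fin.suc (partner u))
-- For odd n the last vertex is its own partner.
partner {suc zero} Fin.zero = Fin.zero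

[2+n]/2≡1+n/2 : ∀ n → suc (suc n) / 2 ≡ suc (n / 2)
[2+n]/2≡1+n/2 n = m/n≡1+[m∸n]/n {suc (suc n)} (s≤s (s≤s z≤n))

0≢[2+n]/2 : ∀ n → 0 ≢ suc (suc n) / 2
0≢[2+n]/2 n eq = 0≢1+n (trans eq ([2+n]/2≡1+n/2 n))

partner-half : ∀ {n} (u : Fin n) → toℕ (partner u) / 2 ≡ toℕ u / 2
partner-half {suc (suc n)} Fin.zero = refl
partner-half {suc (suc n)} (Fin.suc Fin.zero) = refl
partner-half {suc (suc n)} (Fin.suc (Fin.suc u)) = begin
  suc (suc (toℕ (partner u))) / 2 ≡⟨ [2+n]/2≡1+n/2 (toℕ (partner u)) ⟩
  suc (toℕ (partner u) / 2)       ≡⟨ cong suc (partner-half u) ⟩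
  suc (toℕ u / 2)                 ≡⟨ [2+n]/2≡1+n/2 (toℕ u) ⟨
  suc (suc (toℕ u)) / 2           ∎
  where open ≡-Reasoning
partner-half {suc zero} Fin.zero = refl

partner-involutive : ∀ {n} (u : Fin n) → partner (partner u) ≡ u
partner-involutive {suc (suc n)} Fin.zero = refl
partner-involutive {suc (suc n)} (Fin.suc Fin.zero) = refl
partner-involutive {suc (suc n)} (Fin.suc (Fin.suc u)) =
  cong (Fin.suc ∘ Fin.suc) (partner-involutive u)
partner-involutive {suc zero} Fin.zero = refl

partner-injective : ∀ {n} {u v : Fin n} → partner u ≡ partner v → u ≡ v
partner-injective {u = u} {v} eq =
  trans (sym (partner-involutive u)) (trans (cong partner eq) (partner-involutive v))

half-equal⇒partner : ∀ {n} (u v : Fin n) → toℕ u / 2 ≡ toℕ v / 2 → u ≢ v → v ≡ partner u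
half-equal⇒partner {suc (suc n)} Fin.zero Fin.zero _ u≢v = ⊥-elim (u≢v refl)
half-equal⇒partner {suc (suc n)} Fin.zero (Fin.suc Fin.zero) _ _ = refl
half-equal⇒partner {suc (suc n)} Fin.zero (Fin.suc (Fin.suc v)) eq _ =
  ⊥-elim (0≢[2+n]/2 (toℕ v) eq)
half-equal⇒partner {suc (suc n)} (Fin.suc Fin.zero) Fin.zero _ _ = refl
half-equal⇒partner {suc (suc n)} (Fin.suc Fin.zero) (Fin.suc Fin.zero) _ u≢v = ⊥-elim (u≢v refl)
half-equal⇒partner {suc (suc n)} (Fin.suc Fin.zero) (Fin.suc (Fin.suc v)) eq _ =
  ⊥-elim (0≢[2+n]/2 (toℕ v) eq)
half-equal⇒partner {suc (suc n)} (Fin.suc (Fin.suc u)) Fin.zero eq _ =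
  ⊥-elim (0≢[2+n]/2 (toℕ u) (sym eq))
half-equal⇒partner {suc (suc n)} (Fin.suc (Fin.suc u)) (Fin.suc Fin.zero) eq _ =
  ⊥-elim (0≢[2+n]/2 (toℕ u) (sym eq))
half-equal⇒partner {suc (suc n)} (Fin.suc (Fin.suc u)) (Fin.suc (Fin.suc v)) eq u≢v =
  cong (Fin.suc ∘ Fin.suc) (half-equal⇒partner u v halves (u≢v ∘ cong (Fin.suc ∘ Fin.suc)))
  where
  halves : toℕ u / 2 ≡ toℕ v / 2
  halves = suc-injective
    (trans (sym ([2+n]/2≡1+n/2 (toℕ u))) (trans eq ([2+n]/2≡1+n/2 (toℕ v))))
half-equal⇒partner {suc zero} Fin.zero Fin.zero _ u≢v = ⊥-elim (u≢v refl)

data Even : ℕ → Set where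
  even-zero : Even zero
  even-2+   : ∀ {n} → Even n → Even (suc (suc n))

even-double : ∀ n → Even (2 * n)
even-double zero = even-zero
even-double (suc n) rewrite +-suc n (n + 0) = even-2+ (even-double n)

partner-irreflexive : ∀ {n} → Even n → (u : Fin n) → partner u ≢ u
partner-irreflexive (even-2+ e) (Fin.suc (Fin.suc u)) eq =
  partner-irreflexive e u (Fin-suc-injective (Fin-suc-injective eq))

lookup-∁ : ∀ {n} (S : Subset n) v → lookup (∁ S) v ≡ not (lookup S v)
lookup-∁ S v = lookup-map v not S

same-side : ∀ {n} (S : Subset n) {u v} → lookup S u ≡ lookup S v →
            (u ∈ S × v ∈ S) ⊎ (u ∈ ∁ S × v ∈ ∁ S)
same-side S {u} {v} eq with lookup S u in u∈?S
... | true  = inj₁ (lookup⇒[]= u S u∈?S , lookup⇒[]= v S (sym eq))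
... | false = inj₂ (lookup⇒[]= u (∁ S) (trans (lookup-∁ S u) (cong not u∈?S)) ,
                    lookup⇒[]= v (∁ S) (trans (lookup-∁ S v) (cong not (sym eq))))

sameTwins⇒determined : ∀ {n} {S T : Subset n} → SameTwins S T →
                       ∃[ h ] (∀ v → lookup T v ≡ h (lookup S v))
sameTwins⇒determined (inj₁ refl) = id , λ _ → refl
sameTwins⇒determined {T = T} (inj₂ refl) = not , λ v →
  trans (sym (not-involutive (lookup T v))) (cong not (sym (lookup-∁ T v)))

Transversal : ∀ {n} → Subset n → Set
Transversal S = ∀ u → lookup S (partner u) ≡ not (lookup S u)

∣x∷not-x∷S∣≡1+∣S∣ : ∀ {n} x (S : Subset n) → ∣ x ∷ not x ∷ S ∣ ≡ suc ∣ S ∣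
∣x∷not-x∷S∣≡1+∣S∣ true  S = refl
∣x∷not-x∷S∣≡1+∣S∣ false S = refl

transversal-size : ∀ {n} → Even n → {S T : Subset n} →
                   Transversal S → Transversal T → ∣ S ∣ ≡ ∣ T ∣
transversal-size even-zero {[]} {[]} _ _ = refl
transversal-size (even-2+ e) {x ∷ _ ∷ S} {y ∷ _ ∷ T} tS tT
  with refl ← tS Fin.zero | refl ← tT Fin.zero = begin
    ∣ x ∷ not x ∷ S ∣ ≡⟨ ∣x∷not-x∷S∣≡1+∣S∣ x S ⟩
    suc ∣ S ∣         ≡⟨ cong suc (transversal-size e {S} {T} (tS ∘ 2+) (tT ∘ 2+)) ⟩
    suc ∣ T ∣         ≡⟨ ∣x∷not-x∷S∣≡1+∣S∣ y T ⟨
    ∣ y ∷ not y ∷ T ∣ ∎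
  where
  open ≡-Reasoning
  2+ : ∀ {n} → Fin n → Fin (suc (suc n))
  2+ = Fin.suc ∘ Fin.suc

lookup≡false⇒∉ : ∀ {n} (S : Subset n) {v} → lookup S v ≡ false → v ∉ S
lookup≡false⇒∉ S v∉?S v∈S with () ← trans (sym ([]=⇒lookup v∈S)) v∉?S

transversal⇒clique : ∀ {ℓ} {S : Subset (2 ^ ℓ)} → Transversal S → IsClique ℓ S
transversal⇒clique {S = S} tS u v u∈S v∈S u≢v =
  u≢v , λ halves → flip (lookup≡false⇒∉ S) v∈S (begin
    lookup S v            ≡⟨ cong (lookup S) (half-equal⇒partner u v halves u≢v) ⟩
    lookup S (partner u)  ≡⟨ tS u ⟩
    not (lookup S u)      ≡⟨ cong not ([]=⇒lookup u∈S) ⟩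
    false                 ∎)
  where open ≡-Reasoning

∣S[u]≔inside∣≡1+∣S∣ : ∀ {n} (S : Subset n) {u} → u ∉ S → ∣ S [ u ]≔ inside ∣ ≡ suc ∣ S ∣
∣S[u]≔inside∣≡1+∣S∣ (outside ∷ S) {Fin.zero} _ = refl
∣S[u]≔inside∣≡1+∣S∣ (inside ∷ S) {Fin.zero} u∉S = ⊥-elim (u∉S here)
∣S[u]≔inside∣≡1+∣S∣ (outside ∷ S) {Fin.suc u} u∉S =
  ∣S[u]≔inside∣≡1+∣S∣ S (u∉S ∘ there)
∣S[u]≔inside∣≡1+∣S∣ (inside ∷ S) {Fin.suc u} u∉S =
  cong suc (∣S[u]≔inside∣≡1+∣S∣ S (u∉S ∘ there))

∈-insert⁻ : ∀ {n} (S : Subset n) {u v} → v ∈ S [ u ]≔ inside → v ≡ u ⊎ v ∈ S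
∈-insert⁻ S {u} {v} v∈S′ with v Fin.≟ u
... | yes v≡u = inj₁ v≡u
... | no v≢u  =
  inj₂ (lookup⇒[]= v S (trans (sym (lookup∘update′ v≢u S inside)) ([]=⇒lookup v∈S′)))

insert-clique : ∀ {ℓ} {S : Subset (2 ^ ℓ)} {u} → IsClique ℓ S →
                (∀ v → v ∈ S → u ≢ v → Adj ℓ u v) → IsClique ℓ (S [ u ]≔ inside)
insert-clique {S = S} cl adj v w v∈S′ w∈S′ v≢w with ∈-insert⁻ S v∈S′ | ∈-insert⁻ S w∈S′
... | inj₁ refl | inj₁ refl = ⊥-elim (v≢w refl)
... | inj₁ refl | inj₂ w∈S  = adj w w∈S v≢w
... | inj₂ v∈S  | inj₁ refl = let w≢v , halves≢ = adj v v∈S (v≢w ∘ sym) in v≢w , halves≢ ∘ sym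
... | inj₂ v∈S  | inj₂ w∈S  = cl v w v∈S w∈S v≢w

maxClique⇒transversal : ∀ {ℓ} → Even (2 ^ ℓ) → {S : Subset (2 ^ ℓ)} →
                        IsMaxClique ℓ S → Transversal S
maxClique⇒transversal {ℓ} ev {S} (cl , max) u
  with lookup S u in u∈?S | lookup S (partner u) in u′∈?S
... | true  | true  =
  ⊥-elim (proj₂ (cl u (partner u) u∈S u′∈S (partner-irreflexive ev u ∘ sym)) (sym (partner-half u)))
  where
  u∈S : u ∈ S
  u∈S = lookup⇒[]= u S u∈?S
  u′∈S : partner u ∈ S
  u′∈S = lookup⇒[]= (partner u) S u′∈?S
... | true  | false = refl
... | false | true  = refl
... | false | false =
  ⊥-elim (1+n≰n (subst (_≤ ∣ S ∣) (∣S[u]≔inside∣≡1+∣S∣ S u∉S) (max _ (insert-clique {ℓ} cl adjacent))))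
  where
  u∉S : u ∉ S
  u∉S = lookup≡false⇒∉ S u∈?S
  adjacent : ∀ v → v ∈ S → u ≢ v → Adj ℓ u v
  adjacent v v∈S u≢v = u≢v , λ halves →
    flip (lookup≡false⇒∉ S) v∈S
      (subst (λ w → lookup S w ≡ false) (sym (half-equal⇒partner u v halves u≢v)) u′∈?S)

transversal⇒maxClique : ∀ {ℓ} → Even (2 ^ ℓ) → {C S : Subset (2 ^ ℓ)} →
                        IsMaxClique ℓ C → Transversal S → IsMaxClique ℓ S
transversal⇒maxClique {ℓ} ev {C} {S} maxC tS = transversal⇒clique {ℓ} tS , λ T clT →
  subst (∣ T ∣ ≤_) (transversal-size ev {C} {S} (maxClique⇒transversal {ℓ} ev maxC) tS)
        (proj₂ maxC T clT)

bits : ∀ {m} → Fin (2 ^ m) → Fin m → Bool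
bits {m} x = Inverse.to 2↔Bool ∘ finToFun {2} {m} x

fromBits : ∀ {m} → (Fin m → Bool) → Fin (2 ^ m)
fromBits {m} f = funToFin {m} {2} (Inverse.from 2↔Bool ∘ f)

bits-fromBits : ∀ {m} (f : Fin m → Bool) → bits (fromBits f) ≗ f
bits-fromBits f j =
  trans (cong (Inverse.to 2↔Bool) (finToFun-funToFin (Inverse.from 2↔Bool ∘ f) j))
        (Inverse.strictlyInverseˡ 2↔Bool (f j))

fromBits-injective : ∀ {m} {f g : Fin m → Bool} → fromBits f ≡ fromBits g → f ≗ g
fromBits-injective {f = f} {g} eq j =
  trans (sym (bits-fromBits f j)) (trans (cong (λ x → bits x j) eq) (bits-fromBits g j))

funToFin-cong : ∀ {m n} {f g : Fin m → Fin n} → f ≗ g → funToFin f ≡ funToFin g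
funToFin-cong {zero} _ = refl
funToFin-cong {suc m} f≗g = cong₂ Fin.combine (f≗g Fin.zero) (funToFin-cong (f≗g ∘ Fin.suc))

bits-injective : ∀ {m} {x y : Fin (2 ^ m)} → bits x ≗ bits y → x ≡ y
bits-injective {m} {x} {y} eq = begin
  x                             ≡⟨ funToFin-finToFin {m} {2} x ⟨
  funToFin (finToFun {2} {m} x) ≡⟨ funToFin-cong digits ⟩
  funToFin (finToFun {2} {m} y) ≡⟨ funToFin-finToFin {m} {2} y ⟩
  y                             ∎
  where
  open ≡-Reasoning
  digits : finToFun {2} {m} x ≗ finToFun y
  digits j = begin
    finToFun x j                    ≡⟨ Inverse.strictlyInverseʳ 2↔Bool (finToFun x j) ⟨
    Inverse.from 2↔Bool (bits x j)  ≡⟨ cong (Inverse.from 2↔Bool) (eq j) ⟩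
    Inverse.from 2↔Bool (bits y j)  ≡⟨ Inverse.strictlyInverseʳ 2↔Bool (finToFun y j) ⟩
    finToFun y j                    ∎

rank : ∀ {n} → Subset n → Fin n → ℕ
rank (_       ∷ S) Fin.zero    = zero
rank (inside  ∷ S) (Fin.suc v) = suc (rank S v)
rank (outside ∷ S) (Fin.suc v) = rank S v

rank<∣S∣ : ∀ {n} (S : Subset n) {v} → v ∈ S → rank S v < ∣ S ∣
rank<∣S∣ (inside  ∷ S) here = s≤s z≤n
rank<∣S∣ (inside  ∷ S) (there v∈S) = s≤s (rank<∣S∣ S v∈S)
rank<∣S∣ (outside ∷ S) (there v∈S) = rank<∣S∣ S v∈S

rank-injective : ∀ {n} (S : Subset n) {u v} → u ∈ S → v ∈ S → rank S u ≡ rank S v → u ≡ v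
rank-injective (_       ∷ S) here here _ = refl
rank-injective (inside  ∷ S) here (there _) ()
rank-injective (inside  ∷ S) (there _) here ()
rank-injective (inside  ∷ S) (there u∈S) (there v∈S) eq =
  cong Fin.suc (rank-injective S u∈S v∈S (suc-injective eq))
rank-injective (outside ∷ S) (there u∈S) (there v∈S) eq =
  cong Fin.suc (rank-injective S u∈S v∈S eq)

signature : ∀ {n k} → Vec (Subset n) k → Fin n → Fin k → Bool
signature C v i = lookup (lookup C i) v

∈-choose : ∀ {n} (S : Subset n) {b v} → lookup S v ≡ b → v ∈ choose b S
∈-choose S {true}  {v} eq = lookup⇒[]= v S eq
∈-choose S {false} {v} eq = lookup⇒[]= v (∁ S) (trans (lookup-∁ S v) (cong not eq))

∈-chosenMeet : ∀ {n k} (C : Vec (Subset n) k) {ε v} → signature C v ≗ ε → v ∈ chosenMeet C ε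
∈-chosenMeet []      _   = ∈⊤
∈-chosenMeet (S ∷ C) σ≗ε =
  x∈p∩q⁺ (∈-choose S (σ≗ε Fin.zero) , ∈-chosenMeet C (σ≗ε ∘ Fin.suc))

chosenMeet-cong : ∀ {n k} (C : Vec (Subset n) k) {ε ε′} → ε ≗ ε′ →
                  chosenMeet C ε ≡ chosenMeet C ε′
chosenMeet-cong []      _    = refl
chosenMeet-cong (S ∷ C) ε≗ε′ =
  cong₂ _∩_ (cong (λ b → choose b S) (ε≗ε′ Fin.zero)) (chosenMeet-cong C (ε≗ε′ ∘ Fin.suc))

Code : ℕ → ℕ → Set
Code n k = Fin n → Fin k → Bool

Antipodal : ∀ {n k} → Code n k → Set
Antipodal w = ∀ v j → w (partner v) j ≡ not (w v j)

InjectiveCode : ∀ {n k} → Code n k → Set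
InjectiveCode w = ∀ u v → w u ≗ w v → u ≡ v

codeCliques : ∀ {n k} → Code n k → Vec (Subset n) k
codeCliques w = tabulate (λ j → tabulate (λ v → w v j))

lookup-codeCliques : ∀ {n k} (w : Code n k) j v → lookup (lookup (codeCliques w) j) v ≡ w v j
lookup-codeCliques w j v =
  trans (cong (λ S → lookup S v) (lookup∘tabulate (λ j → tabulate (λ v → w v j)) j))
        (lookup∘tabulate (λ v → w v j) v)

codeCliques-transversal : ∀ {n k} (w : Code n k) → Antipodal w →
                          ∀ j → Transversal (lookup (codeCliques w) j)
codeCliques-transversal w antipodal j v = begin
  lookup D (partner v)  ≡⟨ lookup-codeCliques w j (partner v) ⟩
  w (partner v) j       ≡⟨ antipodal v j ⟩
  not (w v j)           ≡⟨ cong not (lookup-codeCliques w j v) ⟨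
  not (lookup D v)      ∎
  where
  open ≡-Reasoning
  D : Subset _
  D = lookup (codeCliques w) j

codeCliques-cover : ∀ {ℓ k} (w : Code (2 ^ ℓ) k) → Antipodal w → InjectiveCode w →
                    ∀ u v → Adj ℓ u v → ∃[ j ] let D = lookup (codeCliques w) j in
                      (u ∈ D × v ∈ D) ⊎ (u ∈ ∁ D × v ∈ ∁ D)
codeCliques-cover w antipodal injective u v (_ , halves≢) with any? (λ j → w u j Bool.≟ w v j)
... | yes (j , agree) = j , same-side (lookup (codeCliques w) j)
        (trans (lookup-codeCliques w j u) (trans agree (sym (lookup-codeCliques w j v))))
... | no disagree = ⊥-elim (halves≢ (trans (sym (partner-half u)) (cong (λ x → toℕ x / 2) u′≡v)))
  where
  u′≡v : partner u ≡ v
  u′≡v = injective (partner u) v λ j →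
    trans (antipodal u j) (sym (¬-not (λ agree → disagree (j , sym agree))))

no-short-injectiveCode : ∀ {n k} → 2 ^ k < n → (w : Code n k) → ¬ InjectiveCode w
no-short-injectiveCode 2^k<n w injective
  with i , j , i<j , eq ← pigeonhole 2^k<n (fromBits ∘ w) =
  <⇒≢ i<j (injective i j (fromBits-injective eq))

codeCliques-determined : ∀ {n k} (w : Code n k) {a b} →
                         SameTwins (lookup (codeCliques w) a) (lookup (codeCliques w) b) →
                         ∃[ h ] (∀ v → w v b ≡ h (w v a))
codeCliques-determined w {a} {b} same with h , determined ← sameTwins⇒determined same =
  h , λ v → trans (sym (lookup-codeCliques w b v))
                  (trans (determined v) (cong h (lookup-codeCliques w a v)))

codeCliques-distinct : ∀ {n k} → 2 ^ k < n → (w : Code n (suc k)) → InjectiveCode w →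
                       DistinctTwins (codeCliques w)
codeCliques-distinct 2^k<n w injective a b a≢b same
  with h , determined ← codeCliques-determined w same =
  no-short-injectiveCode 2^k<n (λ v → w v ∘ punchIn b) λ u v eq → injective u v (agree eq)
  where
  agree-off-b : ∀ {u v} → (w u ∘ punchIn b) ≗ (w v ∘ punchIn b) → ∀ k → b ≢ k → w u k ≡ w v k
  agree-off-b {u} {v} eq k b≢k =
    subst (λ k → w u k ≡ w v k) (punchIn-punchOut b≢k) (eq (punchOut b≢k))
  agree : ∀ {u v} → (w u ∘ punchIn b) ≗ (w v ∘ punchIn b) → w u ≗ w v
  agree {u} {v} eq k with b Fin.≟ k
  ... | no b≢k   = agree-off-b eq k b≢k
  ... | yes refl =
    trans (determined u) (trans (cong h (agree-off-b eq a (a≢b ∘ sym))) (sym (determined v)))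

xor-injectiveʳ : ∀ a {x y} → a xor x ≡ a xor y → x ≡ y
xor-injectiveʳ false eq = eq
xor-injectiveʳ true  eq = not-injective eq

module Extension {n δ m} (C : Vec (Subset n) (suc δ))
                 (transversal : ∀ i → Transversal (lookup C i))
                 (cell-bound : ∀ ε → ∣ chosenMeet C ε ∣ ≤ 2 ^ m) where

  σ : Code n (suc δ)
  σ = signature C

  first : Subset n
  first = lookup C Fin.zero

  σ-antipodal : Antipodal σ
  σ-antipodal v i = transversal i v

  cell : Fin n → Subset n
  cell v = chosenMeet C (σ v)

  ∈-cell : ∀ {u v} → σ u ≗ σ v → u ∈ cell v
  ∈-cell = ∈-chosenMeet C

  cellRank : Fin n → Fin (2 ^ m)
  cellRank v = fromℕ< (<-≤-trans (rank<∣S∣ (cell v) (∈-cell {v} λ _ → refl)) (cell-bound (σ v)))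

  cellRank-injective : ∀ {u v} → σ u ≗ σ v → cellRank u ≡ cellRank v → u ≡ v
  cellRank-injective {u} {v} σ≗ eq =
    rank-injective (cell v) (∈-cell σ≗) (∈-cell {v} λ _ → refl) (begin
    rank (cell v) u  ≡⟨ cong (λ S → rank S u) (chosenMeet-cong C σ≗) ⟨
    rank (cell u) u  ≡⟨ toℕ-fromℕ< _ ⟨
    toℕ (cellRank u) ≡⟨ cong toℕ eq ⟩
    toℕ (cellRank v) ≡⟨ toℕ-fromℕ< _ ⟩
    rank (cell v) v  ∎)
    where open ≡-Reasoning

  pick : Bool → Fin n → Fin n
  pick true  v = v
  pick false v = partner v

  pick-partner : ∀ b v → pick (not b) (partner v) ≡ pick b v
  pick-partner true  v = partner-involutive v
  pick-partner false v = refl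

  pick-injective : ∀ b {u v} → pick b u ≡ pick b v → u ≡ v
  pick-injective true  eq = eq
  pick-injective false eq = partner-injective eq

  σ-pick : ∀ b {u v} → σ u ≗ σ v → σ (pick b u) ≗ σ (pick b v)
  σ-pick true  σ≗ = σ≗
  σ-pick false {u} {v} σ≗ i =
    trans (σ-antipodal u i) (trans (cong not (σ≗ i)) (sym (σ-antipodal v i)))

  representative : Fin n → Fin n
  representative v = pick (lookup first v) v

  representative-partner : ∀ v → representative (partner v) ≡ representative v
  representative-partner v =
    trans (cong (λ b → pick b (partner v)) (σ-antipodal v Fin.zero)) (pick-partner (lookup first v) v)

  representative-injective : ∀ {u v} → σ u ≗ σ v → representative u ≡ representative v → u ≡ v
  representative-injective {u} {v} σ≗ eq =
    pick-injective (lookup first u) (trans eq (cong (λ b → pick b v) (sym (σ≗ Fin.zero))))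

  σ-representative : ∀ {u v} → σ u ≗ σ v → σ (representative u) ≗ σ (representative v)
  σ-representative {u} {v} σ≗ =
    subst (λ b → σ (representative u) ≗ σ (pick b v)) (σ≗ Fin.zero) (σ-pick (lookup first u) σ≗)

  rankDigits : Code n m
  rankDigits v = bits (cellRank (representative v))

  rankWord : Code n m
  rankWord v j = not (lookup first v) xor rankDigits v j

  rankWord-antipodal : Antipodal rankWord
  rankWord-antipodal v j = begin
    not (lookup first (partner v)) xor rankDigits (partner v) j
      ≡⟨ cong₂ (λ b x → not b xor x) (σ-antipodal v Fin.zero)
               (cong (λ w → bits (cellRank w) j) (representative-partner v)) ⟩
    not (not (lookup first v)) xor rankDigits v j
      ≡⟨ not-distribˡ-xor (not (lookup first v)) (rankDigits v j) ⟨
    not (not (lookup first v) xor rankDigits v j)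
      ∎
    where open ≡-Reasoning

  word : Code n (suc δ + m)
  word v = σ v ++ rankWord v

  word-antipodal : Antipodal word
  word-antipodal v k with splitAt (suc δ) k
  ... | inj₁ i = σ-antipodal v i
  ... | inj₂ j = rankWord-antipodal v j

  word-injective : InjectiveCode word
  word-injective u v eq =
    representative-injective σ≗ (cellRank-injective (σ-representative σ≗) (bits-injective digits≗))
    where
    σ≗ : σ u ≗ σ v
    σ≗ = ++-injectiveˡ (σ u) (σ v) eq
    digits≗ : rankDigits u ≗ rankDigits v
    digits≗ j = xor-injectiveʳ (not (lookup first u)) (begin
      not (lookup first u) xor rankDigits u j  ≡⟨ ++-injectiveʳ (σ u) (σ v) eq j ⟩
      not (lookup first v) xor rankDigits v j  ≡⟨ cong (λ b → not b xor rankDigits v j) (σ≗ Fin.zero) ⟨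
      not (lookup first u) xor rankDigits v j  ∎)
      where open ≡-Reasoning

  codeCliques-extends : ∀ i → lookup (codeCliques word) (i ↑ˡ m) ≡ lookup C i
  codeCliques-extends i = begin
    lookup (codeCliques word) (i ↑ˡ m)
      ≡⟨ lookup∘tabulate (λ k → tabulate (λ v → word v k)) (i ↑ˡ m) ⟩
    tabulate (λ v → word v (i ↑ˡ m))
      ≡⟨ tabulate-cong (λ v → lookup-++ˡ (σ v) (rankWord v) i) ⟩
    tabulate (lookup (lookup C i))
      ≡⟨ tabulate∘lookup (lookup C i) ⟩
    lookup C i
      ∎
    where open ≡-Reasoning

lemma8 : (ℓ δ : ℕ) → 1 ≤ ℓ → 1 ≤ δ → δ ≤ ℓ →
         (C₀ : Vec (Subset (2 ^ ℓ)) δ) →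
         (∀ i → IsMaxClique ℓ (lookup C₀ i)) →
         DistinctTwins C₀ →
         (∀ (ε : Fin δ → Bool) → ∣ chosenMeet C₀ ε ∣ ≡ 2 ^ (ℓ ∸ δ)) →
         ∃[ D ] (IsTwinCliqueCover ℓ ℓ D × DistinctTwins D ×
                 (∀ i → ∃[ j ] SameTwins (lookup C₀ i) (lookup D j)))
lemma8 ℓ zero _ () _ _ _ _ _
lemma8 ℓ (suc δ) _ _ δ≤ℓ C₀ maxClique _ cellSize with m , refl ← m≤n⇒∃[o]m+o≡n δ≤ℓ =
  codeCliques word ,
  (maxCliques , codeCliques-cover {suc δ + m} word word-antipodal word-injective) ,
  codeCliques-distinct {k = δ + m} (^-monoʳ-< 2 (s≤s (s≤s z≤n)) (n<1+n (δ + m))) word word-injective ,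
  λ i → i ↑ˡ m , inj₁ (sym (codeCliques-extends i))
  where
  even : Even (2 ^ (suc δ + m))
  even = even-double (2 ^ (δ + m))
  open Extension {m = m} C₀ (λ i → maxClique⇒transversal {suc δ + m} even (maxClique i))
                            (λ ε → ≤-reflexive (trans (cellSize ε) (cong (2 ^_) (m+n∸m≡n (suc δ) m))))
  maxCliques : ∀ j → IsMaxClique (suc δ + m) (lookup (codeCliques word) j)
  maxCliques j = transversal⇒maxClique {suc δ + m} even (maxClique Fin.zero)
                                       (codeCliques-transversal word word-antipodal j)
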